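{- Let $(G,*)$ be a groupoid and let $t\in\mathcal F_n$ be an arbitrary full linear term, written in its leftmost decomposition $t=[t_0,t_1,\dots,t_m]$ with $|t_0|=1$. (i) If $(G,*)$ satisfies $w(x(yz))\approx w((xy)z)$, then $(G,*)$ satisfies $t\approx[t_0,t_1^{\mathrm L},\dots,t_m^{\mathrm L}]$ and $t\approx[t_0,t_1^{\mathrm R},\dots,t_m^{\mathrm R}]$. (ii) If $(G,*)$ satisfies $w(x(yz))\approx w((xy)z)$ and either $x(yz)\approx x(zy)$ or $xy\approx yx$, then $(G,*)$ satisfies $t\approx[t_0,t_1^{\mathrm L<},\dots,t_m^{\mathrm L<}]$ and $t\approx[t_0,t_1^{\mathrm R<},\dots,t_m^{\mathrm R<}]$. (iii) If $(G,*)$ satisfies $(xy)z\approx(xz)y$, then $(G,*)$ satisfies $t\approx[t_0,t_{\sigma(1)},\dots,t_{\sigma(m)}]$ for every permutation $\sigma$ of $\{1,\dots,m\}$. (iv) If $(G,*)$ satisfies $x(yz)\approx x(zy)$ and $(xy)z\approx(xz)y$, then $(G,*)$ satisfies $t\approx[t_0,t_1^{\mathrm L<},\dots,t_m^{\mathrm L<}]$.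
   Context: A groupoid $(G,*)$ is a set with a binary operation; terms are built from variables using the binary operation, written as juxtaposition with parentheses. $\mathcal F_n$ is the set of full linear terms over $x_1,\dots,x_n$: terms in which each of $x_1,\dots,x_n$ occurs exactly once. A term is linear if no variable occurs twice; $|t|$ is the number of variables in $t$. A groupoid satisfies an identity $s\approx t$ if $s$ and $t$ take equal values in $G$ under every assignment of elements of $G$ to the variables. The leftmost bracketing is defined by $[t_1]:=t_1$ and $[t_1,\dots,t_{k+1}]:=([t_1,\dots,t_k]\,t_{k+1})$; the rightmost bracketing by $\langle t_1\rangle:=t_1$ and $\langle t_1,\dots,t_{k+1}\rangle:=(t_1\langle t_2,\dots,t_{k+1}\rangle)$. Every term can be written uniquely as $t=[t_0,t_1,\dots,t_m]$ with $t_0$ a single variable (leftmost decomposition). For a linear term $s$ whose variables, read left to right, are $x_{i_1},\dots,x_{i_k}$, and with $j_1<\dots<j_k$ the same indices sorted increasingly, set $s^{\mathrm L}:=[x_{i_1},\dots,x_{i_k}]$, $s^{\mathrm L<}:=[x_{j_1},\dots,x_{j_k}]$, $s^{\mathrm R}:=\langle x_{i_1},\dots,x_{i_k}\rangle$, $s^{\mathrm R<}:=\langle x_{j_1},\dots,x_{j_k}\rangle$. -}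

module Defs where

open import Data.Nat using (ℕ)
open import Data.Fin using (Fin; _≤?_)
open import Data.List using (List; []; _∷_; _++_; map; lookup; length; tabulate; allFin)
open import Data.List.NonEmpty using (List⁺; _∷_; [_]; _⁺++⁺_; toList)
open import Data.List.Relation.Binary.Permutation.Propositional using (_↭_)
open import Data.Fin.Permutation using (Permutation′; _⟨$⟩ʳ_)
open import Relation.Nullary using (yes; no)
open import Relation.Binary.PropositionalEquality using (_≡_)

infixl 7 _·_
data Term (n : ℕ) : Set where
  var : Fin n → Term n
  _·_ : Term n → Term n → Term n

vars : ∀ {n} → Term n → List⁺ (Fin n)
vars (var i) = [ i ]
vars (s · u) = vars s ⁺++⁺ vars u

-- t ∈ 𝓕_n : each of x_1 … x_n occurs exactly once
Full : ∀ {n} → Term n → Set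
Full {n} t = toList (vars t) ↭ allFin n

eval : ∀ {G : Set} (_∙_ : G → G → G) {n} → (Fin n → G) → Term n → G
eval _∙_ ρ (var i) = ρ i
eval _∙_ ρ (s · u) = eval _∙_ ρ s ∙ eval _∙_ ρ u

Satisfies : ∀ {G : Set} (_∙_ : G → G → G) {n} → Term n → Term n → Set
Satisfies {G} _∙_ {n} s t = ∀ (ρ : Fin n → G) → eval _∙_ ρ s ≡ eval _∙_ ρ t

-- leftmost bracketing  [t₀, t₁, …, tₘ] = lbr t₀ (t₁ ∷ … ∷ tₘ ∷ [])
lbr : ∀ {n} → Term n → List (Term n) → Term n
lbr t []       = t
lbr t (s ∷ ss) = lbr (t · s) ss

-- rightmost bracketing  ⟨t₀, t₁, …, tₘ⟩ = rbr t₀ (t₁ ∷ … ∷ tₘ ∷ [])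
rbr : ∀ {n} → Term n → List (Term n) → Term n
rbr t []       = t
rbr t (s ∷ ss) = t · rbr s ss

-- leftmost decomposition t = [t₀, t₁, …, tₘ] with t₀ = var (head t),
-- (t₁, …, tₘ) = args t
head : ∀ {n} → Term n → Fin n
head (var i) = i
head (s · u) = head s

args : ∀ {n} → Term n → List (Term n)
args (var i) = []
args (s · u) = args s ++ (u ∷ [])

insert : ∀ {n} → Fin n → List (Fin n) → List⁺ (Fin n)
insert x []       = x ∷ []
insert x (y ∷ ys) with x ≤? y
... | yes _ = x ∷ (y ∷ ys)
... | no  _ = y ∷ toList (insert x ys)

sortL : ∀ {n} → List (Fin n) → List (Fin n)
sortL []       = []
sortL (x ∷ xs) = toList (insert x (sortL xs))

sort⁺ : ∀ {n} → List⁺ (Fin n) → List⁺ (Fin n)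
sort⁺ (x ∷ xs) = insert x (sortL xs)

lbrV : ∀ {n} → List⁺ (Fin n) → Term n
lbrV (i ∷ is) = lbr (var i) (map var is)

rbrV : ∀ {n} → List⁺ (Fin n) → Term n
rbrV (i ∷ is) = rbr (var i) (map var is)

_ᴸ : ∀ {n} → Term n → Term n
s ᴸ = lbrV (vars s)

_ᴸ< : ∀ {n} → Term n → Term n
s ᴸ< = lbrV (sort⁺ (vars s))

_ᴿ : ∀ {n} → Term n → Term n
s ᴿ = rbrV (vars s)

_ᴿ< : ∀ {n} → Term n → Term n
s ᴿ< = rbrV (sort⁺ (vars s))

permuteArgs : ∀ {A : Set} (xs : List A) → Permutation′ (length xs) → List A
permuteArgs xs σ = tabulate (λ i → lookup xs (σ ⟨$⟩ʳ i))

-- Every term is its head variable followed by its arguments, t = [t₀, t₁, …, tₘ], and the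
-- outer left bracketing only ever places each tᵢ as a right factor.  So it suffices to know
-- that tᵢ and its normal form are equal as right factors, w ∙ tᵢ ≈ w ∙ tᵢ′.  Under
-- w(x(yz)) ≈ w((xy)z) every right factor can be rebracketed to the right; a further
-- commutation w(xy) ≈ w(yx) then also lets adjacent variables be swapped, which is enough
-- to run insertion sort.  For (iii), right commutativity (xy)z ≈ (xz)y makes the left fold
-- a ∙ t₁ ∙ ⋯ ∙ tₘ invariant under permuting t₁, …, tₘ, and (iv) reduces to (ii) because the
-- two identities of (iv) imply w(x(yz)) ≈ w((xy)z).
module Submission where

open import Defs
open import Data.Nat using (ℕ; zero; suc)
open import Data.List using (List; []; _∷_; _++_; map; length; tabulate; lookup)
open import Data.List.Properties using (++-assoc; ++-identityʳ; tabulate-lookup)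
open import Data.List.NonEmpty using (List⁺; _∷_; [_]; _⁺++⁺_; _⁺++_; toList)
open import Data.List.NonEmpty.Properties using (⁺++⁺-assoc)
open import Data.Fin using (Fin; zero; suc; _≤?_)
open import Data.Fin.Permutation using (Permutation′; _⟨$⟩ʳ_; _⟨$⟩ˡ_; inverseʳ; remove; punchIn-permute′)
open import Data.Vec.Functional using (Vector; foldl; removeAt)
open import Data.Product using (_×_; _,_)
open import Data.Sum using (_⊎_; [_,_]′)
open import Function using (id; _∘_)
open import Relation.Nullary using (yes; no)
open import Relation.Binary.PropositionalEquality using (_≡_; refl; sym; trans; cong; module ≡-Reasoning)
import Algebra.Definitions as AlgebraDefinitions
open ≡-Reasoning

lbr-∷ʳ : ∀ {n} (a : Term n) xs u → lbr a (xs ++ u ∷ []) ≡ lbr a xs · u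
lbr-∷ʳ a []       u = refl
lbr-∷ʳ a (x ∷ xs) u = lbr-∷ʳ (a · x) xs u

lbr-head-args : ∀ {n} (t : Term n) → lbr (var (head t)) (args t) ≡ t
lbr-head-args (var i) = refl
lbr-head-args (s · u) = trans (lbr-∷ʳ (var (head s)) (args s) u) (cong (_· u) (lbr-head-args s))

⁺++-identityʳ : ∀ {A : Set} (L : List⁺ A) → L ⁺++ [] ≡ L
⁺++-identityʳ (h ∷ tl) = cong (h ∷_) (++-identityʳ tl)

⁺++⁺-[]-⁺++ : ∀ {A : Set} (L : List⁺ A) x xs → (L ⁺++⁺ [ x ]) ⁺++ xs ≡ L ⁺++ (x ∷ xs)
⁺++⁺-[]-⁺++ (h ∷ tl) x xs = cong (h ∷_) (++-assoc tl (x ∷ []) xs)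

vars-lbr-var : ∀ {n} (t : Term n) xs → vars (lbr t (map var xs)) ≡ vars t ⁺++ xs
vars-lbr-var t []       = sym (⁺++-identityʳ (vars t))
vars-lbr-var t (x ∷ xs) = trans (vars-lbr-var (t · var x) xs) (⁺++⁺-[]-⁺++ (vars t) x xs)

vars-lbrV : ∀ {n} (L : List⁺ (Fin n)) → vars (lbrV L) ≡ L
vars-lbrV (i ∷ is) = vars-lbr-var (var i) is

module _ {G : Set} (_∙_ : G → G → G) where

  open AlgebraDefinitions (_≡_ {A = G}) using (Commutative)

  RightFactorAssociative : Set
  RightFactorAssociative = ∀ w x y z → (w ∙ (x ∙ (y ∙ z))) ≡ (w ∙ ((x ∙ y) ∙ z))

  RightFactorCommutative : Set
  RightFactorCommutative = ∀ w x y → (w ∙ (x ∙ y)) ≡ (w ∙ (y ∙ x))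

  RightCommutative : Set
  RightCommutative = ∀ x y z → ((x ∙ y) ∙ z) ≡ ((x ∙ z) ∙ y)

  commutative⇒rightFactorCommutative : Commutative _∙_ → RightFactorCommutative
  commutative⇒rightFactorCommutative comm w x y = cong (w ∙_) (comm x y)

  rightFactorAssociative : RightFactorCommutative → RightCommutative → RightFactorAssociative
  rightFactorAssociative swap rcomm w x y z = begin
    w ∙ (x ∙ (y ∙ z))  ≡⟨ swap w x (y ∙ z) ⟩
    w ∙ ((y ∙ z) ∙ x)  ≡⟨ cong (w ∙_) (rcomm y z x) ⟩
    w ∙ ((y ∙ x) ∙ z)  ≡⟨ swap w (y ∙ x) z ⟩
    w ∙ (z ∙ (y ∙ x))  ≡⟨ cong (w ∙_) (swap z y x) ⟩
    w ∙ (z ∙ (x ∙ y))  ≡⟨ swap w z (x ∙ y) ⟩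
    w ∙ ((x ∙ y) ∙ z)  ∎

  infix 4 _≈ʳ_
  _≈ʳ_ : G → G → Set
  a ≈ʳ b = ∀ w → (w ∙ a) ≡ (w ∙ b)

  ≈ʳ-sym : ∀ {a b} → a ≈ʳ b → b ≈ʳ a
  ≈ʳ-sym p w = sym (p w)

  ≈ʳ-trans : ∀ {a b c} → a ≈ʳ b → b ≈ʳ c → a ≈ʳ c
  ≈ʳ-trans p q w = trans (p w) (q w)

  foldl-cong : ∀ {k} a (f g : Vector G k) → (∀ i → f i ≡ g i) → foldl _∙_ a f ≡ foldl _∙_ a g
  foldl-cong {zero}  a f g f≗g = refl
  foldl-cong {suc k} a f g f≗g =
    trans (cong (λ x → foldl _∙_ (a ∙ x) (f ∘ suc)) (f≗g zero)) (foldl-cong _ (f ∘ suc) (g ∘ suc) (f≗g ∘ suc))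

  module _ (rcomm : RightCommutative) where

    foldl-removeAt : ∀ {k} a (f : Vector G (suc k)) i → foldl _∙_ a f ≡ foldl _∙_ (a ∙ f i) (removeAt f i)
    foldl-removeAt a f zero = refl
    foldl-removeAt {suc k} a f (suc i) =
      trans (foldl-removeAt (a ∙ f zero) (f ∘ suc) i)
            (cong (λ b → foldl _∙_ b (removeAt (f ∘ suc) i)) (rcomm a (f zero) (f (suc i))))

    foldl-permute : ∀ {k} a (f : Vector G k) (σ : Permutation′ k) → foldl _∙_ a f ≡ foldl _∙_ a (f ∘ (σ ⟨$⟩ʳ_))
    foldl-permute {zero}  a f σ = refl
    foldl-permute {suc k} a f σ = begin
      foldl _∙_ (a ∙ f zero) (f ∘ suc)
        ≡⟨ cong (λ i → foldl _∙_ (a ∙ f i) (f ∘ suc)) (sym (inverseʳ σ)) ⟩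
      foldl _∙_ (a ∙ σf σ₀) (f ∘ suc)
        ≡⟨ foldl-permute (a ∙ σf σ₀) (f ∘ suc) (remove σ₀ σ) ⟩
      foldl _∙_ (a ∙ σf σ₀) (f ∘ suc ∘ (remove σ₀ σ ⟨$⟩ʳ_))
        ≡⟨ foldl-cong _ _ _ (λ j → cong f (sym (punchIn-permute′ σ zero j))) ⟩
      foldl _∙_ (a ∙ σf σ₀) (removeAt σf σ₀)
        ≡⟨ sym (foldl-removeAt a σf σ₀) ⟩
      foldl _∙_ a σf ∎
      where
      σ₀ : Fin (suc k)
      σ₀ = σ ⟨$⟩ˡ zero
      σf : Vector G (suc k)
      σf = f ∘ (σ ⟨$⟩ʳ_)

  module _ {n : ℕ} (ρ : Fin n → G) where

    private
      ev : Term n → G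
      ev = eval _∙_ ρ

    eval-lbr-map : (f : Term n → Term n) → (∀ s → ev s ≈ʳ ev (f s)) →
                   ∀ {a b} xs → ev a ≡ ev b → ev (lbr a xs) ≡ ev (lbr b (map f xs))
    eval-lbr-map f s≈f []       a≡b = a≡b
    eval-lbr-map f s≈f {b = b} (s ∷ xs) a≡b =
      eval-lbr-map f s≈f xs (trans (cong (_∙ ev s) a≡b) (s≈f s (ev b)))

    eval-lbr-tabulate : ∀ {k} a (g : Fin k → Term n) → ev (lbr a (tabulate g)) ≡ foldl _∙_ (ev a) (ev ∘ g)
    eval-lbr-tabulate {zero}  a g = refl
    eval-lbr-tabulate {suc k} a g = eval-lbr-tabulate (a · g zero) (g ∘ suc)

  module _ (assoc : RightFactorAssociative) {n : ℕ} (ρ : Fin n → G) where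

    private
      ev : Term n → G
      ev = eval _∙_ ρ

    ·-rbrV-≈ʳ : ∀ s L → ev (s · rbrV L) ≈ʳ ev (rbrV (vars s ⁺++⁺ L))
    ·-rbrV-≈ʳ (var i) (j ∷ js) w = refl
    ·-rbrV-≈ʳ (a · b) L w = begin
      w ∙ ((ev a ∙ ev b) ∙ ev (rbrV L))             ≡⟨ sym (assoc w _ _ _) ⟩
      w ∙ (ev a ∙ (ev b ∙ ev (rbrV L)))             ≡⟨ cong (w ∙_) (·-rbrV-≈ʳ b L (ev a)) ⟩
      w ∙ (ev a ∙ ev (rbrV (vars b ⁺++⁺ L)))        ≡⟨ ·-rbrV-≈ʳ a (vars b ⁺++⁺ L) w ⟩
      w ∙ ev (rbrV (vars a ⁺++⁺ (vars b ⁺++⁺ L)))   ≡⟨ cong (λ M → w ∙ ev (rbrV M)) (sym (⁺++⁺-assoc (vars a) (vars b) L)) ⟩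
      w ∙ ev (rbrV ((vars a ⁺++⁺ vars b) ⁺++⁺ L))   ∎

    ᴿ-≈ʳ : ∀ s → ev s ≈ʳ ev (s ᴿ)
    ᴿ-≈ʳ (var i) w = refl
    ᴿ-≈ʳ (a · b) w = trans (cong (w ∙_) (ᴿ-≈ʳ b (ev a))) (·-rbrV-≈ʳ a (vars b) w)

    lbrV-≈ʳ-rbrV : ∀ L → ev (lbrV L) ≈ʳ ev (rbrV L)
    lbrV-≈ʳ-rbrV L w = trans (ᴿ-≈ʳ (lbrV L) w) (cong (λ M → w ∙ ev (rbrV M)) (vars-lbrV L))

    ᴸ-≈ʳ : ∀ s → ev s ≈ʳ ev (s ᴸ)
    ᴸ-≈ʳ s = ≈ʳ-trans (ᴿ-≈ʳ s) (≈ʳ-sym (lbrV-≈ʳ-rbrV (vars s)))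

  module _ (assoc : RightFactorAssociative) (swap : RightFactorCommutative) {n : ℕ} (ρ : Fin n → G) where

    private
      ev : Term n → G
      ev = eval _∙_ ρ

    rbrV-∷-≈ʳ : ∀ x L L′ → ev (rbrV L) ≈ʳ ev (rbrV L′) → ev (rbrV (x ∷ toList L)) ≈ʳ ev (rbrV (x ∷ toList L′))
    rbrV-∷-≈ʳ x (_ ∷ _) (_ ∷ _) L≈L′ w = cong (w ∙_) (L≈L′ (ρ x))

    rbrV-swap-≈ʳ : ∀ x y ys → ev (rbrV (x ∷ y ∷ ys)) ≈ʳ ev (rbrV (y ∷ x ∷ ys))
    rbrV-swap-≈ʳ x y []       w = swap w (ρ x) (ρ y)
    rbrV-swap-≈ʳ x y (z ∷ zs) w = begin
      w ∙ (ρ x ∙ (ρ y ∙ r))  ≡⟨ swap w _ _ ⟩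
      w ∙ ((ρ y ∙ r) ∙ ρ x)  ≡⟨ sym (assoc w _ _ _) ⟩
      w ∙ (ρ y ∙ (r ∙ ρ x))  ≡⟨ cong (w ∙_) (swap (ρ y) r (ρ x)) ⟩
      w ∙ (ρ y ∙ (ρ x ∙ r))  ∎
      where
      r : G
      r = ev (rbrV (z ∷ zs))

    rbrV-insert-≈ʳ : ∀ x ys → ev (rbrV (x ∷ ys)) ≈ʳ ev (rbrV (insert x ys))
    rbrV-insert-≈ʳ x [] w = refl
    rbrV-insert-≈ʳ x (y ∷ ys) with x ≤? y
    ... | yes _ = λ w → refl
    ... | no  _ = ≈ʳ-trans (rbrV-swap-≈ʳ x y ys) (rbrV-∷-≈ʳ y (x ∷ ys) (insert x ys) (rbrV-insert-≈ʳ x ys))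

    rbrV-sort⁺-≈ʳ : ∀ L → ev (rbrV L) ≈ʳ ev (rbrV (sort⁺ L))
    rbrV-sort⁺-≈ʳ (x ∷ xs) = cons-sorted x xs
      where
      cons-sorted : ∀ x xs → ev (rbrV (x ∷ xs)) ≈ʳ ev (rbrV (insert x (sortL xs)))
      cons-sorted x []       w = refl
      cons-sorted x (y ∷ ys) =
        ≈ʳ-trans (rbrV-∷-≈ʳ x (y ∷ ys) (insert y (sortL ys)) (cons-sorted y ys))
                 (rbrV-insert-≈ʳ x (sortL (y ∷ ys)))

    ᴿ<-≈ʳ : ∀ s → ev s ≈ʳ ev (s ᴿ<)
    ᴿ<-≈ʳ s = ≈ʳ-trans (ᴿ-≈ʳ assoc ρ s) (rbrV-sort⁺-≈ʳ (vars s))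

    ᴸ<-≈ʳ : ∀ s → ev s ≈ʳ ev (s ᴸ<)
    ᴸ<-≈ʳ s = ≈ʳ-trans (ᴿ<-≈ʳ s) (≈ʳ-sym (lbrV-≈ʳ-rbrV assoc ρ (sort⁺ (vars s))))

  satisfies-args-map : ∀ {n} (f : Term n → Term n) → (∀ ρ s → eval _∙_ ρ s ≈ʳ eval _∙_ ρ (f s)) →
                       ∀ t → Satisfies _∙_ t (lbr (var (head t)) (map f (args t)))
  satisfies-args-map f s≈f t ρ = begin
    eval _∙_ ρ t                               ≡⟨ cong (eval _∙_ ρ) (sym (lbr-head-args t)) ⟩
    eval _∙_ ρ (lbr (var (head t)) (args t))   ≡⟨ eval-lbr-map ρ f (s≈f ρ) (args t) refl ⟩
    eval _∙_ ρ (lbr (var (head t)) (map f (args t))) ∎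

  satisfies-args-permute : RightCommutative → ∀ {n} (t : Term n) σ →
                           Satisfies _∙_ t (lbr (var (head t)) (permuteArgs (args t) σ))
  satisfies-args-permute rcomm {n} t σ ρ = begin
    ev t                                        ≡⟨ cong ev (sym (lbr-head-args t)) ⟩
    ev (lbr a xs)                               ≡⟨ cong (ev ∘ lbr a) (sym (tabulate-lookup xs)) ⟩
    ev (lbr a (tabulate (lookup xs)))           ≡⟨ eval-lbr-tabulate ρ a (lookup xs) ⟩
    foldl _∙_ (ev a) (ev ∘ lookup xs)           ≡⟨ foldl-permute rcomm (ev a) (ev ∘ lookup xs) σ ⟩
    foldl _∙_ (ev a) (ev ∘ lookup xs ∘ (σ ⟨$⟩ʳ_)) ≡⟨ sym (eval-lbr-tabulate ρ a (lookup xs ∘ (σ ⟨$⟩ʳ_))) ⟩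
    ev (lbr a (permuteArgs xs σ))               ∎
    where
    ev : Term n → G
    ev = eval _∙_ ρ
    a : Term n
    a = var (head t)
    xs : List (Term n)
    xs = args t

lemma2p1 : (G : Set) (_∙_ : G → G → G) (n : ℕ) (t : Term n) → Full t →
    ((∀ w x y z → (w ∙ (x ∙ (y ∙ z))) ≡ (w ∙ ((x ∙ y) ∙ z))) →
      Satisfies _∙_ t (lbr (var (head t)) (map _ᴸ (args t)))
      × Satisfies _∙_ t (lbr (var (head t)) (map _ᴿ (args t))))
  × ((∀ w x y z → (w ∙ (x ∙ (y ∙ z))) ≡ (w ∙ ((x ∙ y) ∙ z))) →
     ((∀ x y z → (x ∙ (y ∙ z)) ≡ (x ∙ (z ∙ y))) ⊎ (∀ x y → (x ∙ y) ≡ (y ∙ x))) →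
      Satisfies _∙_ t (lbr (var (head t)) (map _ᴸ< (args t)))
      × Satisfies _∙_ t (lbr (var (head t)) (map _ᴿ< (args t))))
  × ((∀ x y z → ((x ∙ y) ∙ z) ≡ ((x ∙ z) ∙ y)) →
      (σ : Permutation′ (length (args t))) →
      Satisfies _∙_ t (lbr (var (head t)) (permuteArgs (args t) σ)))
  × ((∀ x y z → (x ∙ (y ∙ z)) ≡ (x ∙ (z ∙ y))) →
     (∀ x y z → ((x ∙ y) ∙ z) ≡ ((x ∙ z) ∙ y)) →
      Satisfies _∙_ t (lbr (var (head t)) (map _ᴸ< (args t))))
lemma2p1 G _∙_ n t _ =
    (λ assoc → satisfies-args-map _∙_ _ᴸ (ᴸ-≈ʳ _∙_ assoc) t
             , satisfies-args-map _∙_ _ᴿ (ᴿ-≈ʳ _∙_ assoc) t)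
  , (λ assoc swap⊎comm →
       let swap = [ id , commutative⇒rightFactorCommutative _∙_ ]′ swap⊎comm
       in satisfies-args-map _∙_ _ᴸ< (ᴸ<-≈ʳ _∙_ assoc swap) t
        , satisfies-args-map _∙_ _ᴿ< (ᴿ<-≈ʳ _∙_ assoc swap) t)
  , (λ rcomm → satisfies-args-permute _∙_ rcomm t)
  , (λ swap rcomm →
       let assoc = rightFactorAssociative _∙_ swap rcomm
       in satisfies-args-map _∙_ _ᴸ< (ᴸ<-≈ʳ _∙_ assoc swap) t)
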